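{- Let $(G,v)$ be a Hamel space over an ordered field $C$. Then $v(G\setminus\{0\})$ is a $C$-linearly independent subset of $G$.
   Context: A $2$-ordered $C$-vector space is a $C$-vector space $G$ with two linear orders $<_0,<_1$, each making $G$ an ordered $C$-vector space (ordered abelian group with $\lambda>0,x>0\Rightarrow\lambda x>0$ for $\lambda\in C$). Put $G_\infty=G\cup\{\infty\}$ with $\infty$ above $G$ in both orders. A Hamel valuation on $G$ is a map $v:G\to G_\infty$ such that for all $x,y\in G$, $\lambda\in C\setminus\{0\}$: $v(x)=\infty$ iff $x=0$; $v(x+y)\geq_0\min_0(v(x),v(y))$; $v(\lambda x)=v(x)$; if $0<_1x<_1y$ then $v(x)\geq_0v(y)$; $v(v(x))=v(x)$ (with $v(\infty)=\infty$); and $v(x)>_10$. A Hamel space is a pair $(G,v)$ with $G$ a $2$-ordered $C$-vector space and $v$ a Hamel valuation on it. -}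

module Defs where

open import Level using (Level; _⊔_)
open import Data.Nat using (ℕ)
import Data.Nat as ℕ
open import Data.Fin using (Fin; zero; suc)
open import Data.Maybe using (Maybe; just; nothing)
open import Data.Product using (Σ; _×_; _,_; ∃)
open import Data.Sum using (_⊎_)
open import Data.Unit using (⊤)
open import Relation.Nullary using (¬_)
open import Relation.Binary.PropositionalEquality using (_≡_)
open import Relation.Binary.Definitions using (Trichotomous; Transitive; Irreflexive)

record IsStrictLinearOrder {a} (A : Set a) (_<_ : A → A → Set a) : Set a where
  field
    irrefl : Irreflexive _≡_ _<_
    trans  : Transitive _<_
    compare : Trichotomous _≡_ _<_

record OrderedField (c : Level) : Set (Level.suc c) where
  infixl 6 _+_
  infixl 7 _*_
  infix 4 _<_
  field
    Carrier : Set c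
    _+_ _*_ : Carrier → Carrier → Carrier
    -_ : Carrier → Carrier
    0# 1# : Carrier
    _<_ : Carrier → Carrier → Set c
    +-assoc : ∀ x y z → (x + y) + z ≡ x + (y + z)
    +-comm : ∀ x y → x + y ≡ y + x
    +-identityˡ : ∀ x → 0# + x ≡ x
    -‿inverseˡ : ∀ x → (- x) + x ≡ 0#
    *-assoc : ∀ x y z → (x * y) * z ≡ x * (y * z)
    *-comm : ∀ x y → x * y ≡ y * x
    *-identityˡ : ∀ x → 1# * x ≡ x
    distribˡ : ∀ x y z → x * (y + z) ≡ (x * y) + (x * z)
    0≢1 : ¬ (0# ≡ 1#)
    inverse : ∀ x → ¬ (x ≡ 0#) → Σ Carrier (λ y → y * x ≡ 1#)
    <-linear : IsStrictLinearOrder Carrier _<_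
    +-mono-< : ∀ x y z → x < y → x + z < y + z
    *-pos : ∀ x y → 0# < x → 0# < y → 0# < x * y

record TwoOrderedVectorSpace {c} (C : OrderedField c) (g : Level) : Set (c ⊔ Level.suc g) where
  module F = OrderedField C
  infixl 6 _+_
  infixr 7 _·_
  field
    Carrier : Set g
    _+_ : Carrier → Carrier → Carrier
    -_ : Carrier → Carrier
    0# : Carrier
    _·_ : F.Carrier → Carrier → Carrier
    +-assoc : ∀ x y z → (x + y) + z ≡ x + (y + z)
    +-comm : ∀ x y → x + y ≡ y + x
    +-identityˡ : ∀ x → 0# + x ≡ x
    -‿inverseˡ : ∀ x → (- x) + x ≡ 0#
    ·-assoc : ∀ λ₁ λ₂ x → (λ₁ F.* λ₂) · x ≡ λ₁ · (λ₂ · x)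
    ·-identity : ∀ x → F.1# · x ≡ x
    ·-distribˡ : ∀ λ₁ x y → λ₁ · (x + y) ≡ (λ₁ · x) + (λ₁ · y)
    ·-distribʳ : ∀ λ₁ λ₂ x → (λ₁ F.+ λ₂) · x ≡ (λ₁ · x) + (λ₂ · x)
    _<₀_ _<₁_ : Carrier → Carrier → Set g
    <₀-linear : IsStrictLinearOrder Carrier _<₀_
    <₁-linear : IsStrictLinearOrder Carrier _<₁_
    +-mono-<₀ : ∀ x y z → x <₀ y → (x + z) <₀ (y + z)
    +-mono-<₁ : ∀ x y z → x <₁ y → (x + z) <₁ (y + z)
    ·-pos₀ : ∀ λ₁ x → F.0# F.< λ₁ → 0# <₀ x → 0# <₀ (λ₁ · x)
    ·-pos₁ : ∀ λ₁ x → F.0# F.< λ₁ → 0# <₁ x → 0# <₁ (λ₁ · x)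

module _ {c g} {C : OrderedField c} (G : TwoOrderedVectorSpace C g) where
  open TwoOrderedVectorSpace G

  -- G∞ = G ∪ {∞}, with ∞ represented by nothing.
  G∞ : Set g
  G∞ = Maybe Carrier

  _≤₀∞_ : G∞ → G∞ → Set g
  _ ≤₀∞ nothing = Level.Lift g ⊤
  nothing ≤₀∞ just _ = Level.Lift g Data.Empty.⊥
    where import Data.Empty
  just x ≤₀∞ just y = (x <₀ y) ⊎ (x ≡ y)

  _<₁∞_ : G∞ → G∞ → Set g
  just x <₁∞ just y = x <₁ y
  just _ <₁∞ nothing = Level.Lift g ⊤
  nothing <₁∞ _ = Level.Lift g Data.Empty.⊥
    where import Data.Empty

  ext : (Carrier → G∞) → G∞ → G∞
  ext v nothing = nothing
  ext v (just x) = v x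

  -- z ≥₀ min₀(a, b), for the linear order ≤₀ on G∞
  ≥₀min : G∞ → G∞ → G∞ → Set g
  ≥₀min z a b = (a ≤₀∞ z) ⊎ (b ≤₀∞ z)

  record IsHamelValuation (v : Carrier → G∞) : Set (c ⊔ g) where
    field
      v-∞ : ∀ x → (v x ≡ nothing → x ≡ 0#) × (x ≡ 0# → v x ≡ nothing)
      v-+ : ∀ x y → ≥₀min (v (x + y)) (v x) (v y)
      v-· : ∀ λ₁ x → ¬ (λ₁ ≡ F.0#) → v (λ₁ · x) ≡ v x
      v-mono : ∀ x y → 0# <₁ x → x <₁ y → v y ≤₀∞ v x
      v-idem : ∀ x → ext v (v x) ≡ v x
      v-pos : ∀ x → just 0# <₁∞ v x

  ∑ : (n : ℕ) → (Fin n → Carrier) → Carrier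
  ∑ ℕ.zero f = 0#
  ∑ (ℕ.suc n) f = f zero + ∑ n (λ i → f (suc i))

  LinearlyIndependent : ∀ {ℓ} → (Carrier → Set ℓ) → Set (c ⊔ g ⊔ ℓ)
  LinearlyIndependent S =
    ∀ (n : ℕ) (e : Fin n → Carrier) →
      (∀ i j → e i ≡ e j → i ≡ j) →
      (∀ i → S (e i)) →
      (a : Fin n → F.Carrier) →
      ∑ n (λ i → a i · e i) ≡ 0# →
      ∀ i → a i ≡ F.0#

record HamelSpace {c} (C : OrderedField c) (g : Level) : Set (c ⊔ Level.suc g) where
  field
    space : TwoOrderedVectorSpace C g
  open TwoOrderedVectorSpace space
  field
    v : Carrier → G∞ space
    isHamel : IsHamelValuation space v

module _ {c g} {C : OrderedField c} (H : HamelSpace C g) where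
  open HamelSpace H
  open TwoOrderedVectorSpace space

  valueSet : Carrier → Set g
  valueSet y = Σ Carrier (λ x → ¬ (x ≡ 0#) × (v x ≡ just y))

-- If x and y have values p <₀ q, then v(x + y) ≥₀ p by the ultrametric inequality, and
-- p = v((x + y) − y) ≥₀ min₀(v(x + y), q) forces v(x + y) ≤₀ p; so v(x + y) = p.
-- Every value is a fixed point of v, hence in a combination of distinct values with some
-- nonzero coefficient the least surviving value is attained and the sum is not 0.
module Submission where

open import Level using (Level; lift)
open import Data.Nat using (zero; suc)
open import Data.Fin using (Fin; zero; suc)
open import Data.Fin.Properties using (suc-injective; 0≢1+n)
open import Data.Vec.Functional using (head; tail)
open import Function using (_∘_)
open import Data.Maybe using (just; nothing)
open import Data.Product using (_,_; proj₂; ∃-syntax)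
open import Data.Sum using (_⊎_; inj₁; inj₂)
open import Data.Empty using (⊥-elim)
open import Relation.Nullary using (¬_; Dec; yes; no)
open import Relation.Binary.Definitions using (tri<; tri≈; tri>)
open import Relation.Binary.PropositionalEquality
open ≡-Reasoning
open import Defs

module OrderedFieldProperties {c} (C : OrderedField c) where
  open OrderedField C
  open IsStrictLinearOrder <-linear using (compare)

  -1#≢0# : - 1# ≢ 0#
  -1#≢0# -1#≡0# = 0≢1 (begin
    0#          ≡⟨ sym (-‿inverseˡ 1#) ⟩
    - 1# + 1#   ≡⟨ cong (_+ 1#) -1#≡0# ⟩
    0# + 1#     ≡⟨ +-identityˡ 1# ⟩
    1#          ∎)

  _≟0# : ∀ x → Dec (x ≡ 0#)
  x ≟0# with compare x 0#
  ... | tri< _ x≢0 _ = no x≢0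
  ... | tri≈ _ x≡0 _ = yes x≡0
  ... | tri> _ x≢0 _ = no x≢0

module VectorSpaceProperties {c g} {C : OrderedField c} (G : TwoOrderedVectorSpace C g) where
  open TwoOrderedVectorSpace G
  open OrderedFieldProperties C using (-1#≢0#)

  +-identityʳ : ∀ x → x + 0# ≡ x
  +-identityʳ x = trans (+-comm x 0#) (+-identityˡ x)

  -‿inverseʳ : ∀ x → x + - x ≡ 0#
  -‿inverseʳ x = trans (+-comm x (- x)) (-‿inverseˡ x)

  +-cancelʳ : ∀ x y → x + y + - y ≡ x
  +-cancelʳ x y = begin
    x + y + - y     ≡⟨ +-assoc x y (- y) ⟩
    x + (y + - y)   ≡⟨ cong (x +_) (-‿inverseʳ y) ⟩
    x + 0#          ≡⟨ +-identityʳ x ⟩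
    x               ∎

  -‿unique : ∀ x y → x + y ≡ 0# → x ≡ - y
  -‿unique x y x+y≡0 = begin
    x               ≡⟨ sym (+-cancelʳ x y) ⟩
    x + y + - y     ≡⟨ cong (_+ - y) x+y≡0 ⟩
    0# + - y        ≡⟨ +-identityˡ (- y) ⟩
    - y             ∎

  ·-zeroˡ : ∀ x → F.0# · x ≡ 0#
  ·-zeroˡ x = begin
    z               ≡⟨ sym (+-cancelʳ z z) ⟩
    z + z + - z     ≡⟨ cong (_+ - z) z+z≡z ⟩
    z + - z         ≡⟨ -‿inverseʳ z ⟩
    0#              ∎
    where
    z = F.0# · x
    z+z≡z : z + z ≡ z
    z+z≡z = trans (sym (·-distribʳ F.0# F.0# x)) (cong (_· x) (F.+-identityˡ F.0#))

  -1·x≡-x : ∀ x → (F.- F.1#) · x ≡ - x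
  -1·x≡-x x = -‿unique _ x (begin
    (F.- F.1#) · x + x             ≡⟨ cong ((F.- F.1#) · x +_) (sym (·-identity x)) ⟩
    (F.- F.1#) · x + F.1# · x      ≡⟨ sym (·-distribʳ (F.- F.1#) F.1# x) ⟩
    (F.- F.1# F.+ F.1#) · x        ≡⟨ cong (_· x) (F.-‿inverseˡ F.1#) ⟩
    F.0# · x                       ≡⟨ ·-zeroˡ x ⟩
    0#                             ∎)

  ∑-zero : ∀ n (a : Fin n → F.Carrier) (e : Fin n → Carrier) →
           (∀ i → a i ≡ F.0#) → ∑ G n (λ i → a i · e i) ≡ 0#
  ∑-zero zero    a e a≡0 = refl
  ∑-zero (suc n) a e a≡0 = begin
    a zero · e zero + ∑ G n (λ i → a (suc i) · e (suc i))
      ≡⟨ cong₂ _+_ (trans (cong (_· e zero) (a≡0 zero)) (·-zeroˡ (e zero)))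
                   (∑-zero n (λ i → a (suc i)) (λ i → e (suc i)) (λ i → a≡0 (suc i))) ⟩
    0# + 0#
      ≡⟨ +-identityˡ 0# ⟩
    0# ∎

module ExtendedOrderProperties {c g} {C : OrderedField c} (G : TwoOrderedVectorSpace C g) where
  open TwoOrderedVectorSpace G
  open IsStrictLinearOrder <₀-linear renaming (irrefl to <₀-irrefl; trans to <₀-trans)

  <₀-≤₀∞-trans : ∀ {p q} w → p <₀ q → _≤₀∞_ G (just q) w → _≤₀∞_ G (just p) w
  <₀-≤₀∞-trans nothing  _   _             = _
  <₀-≤₀∞-trans (just r) p<q (inj₁ q<r)    = inj₁ (<₀-trans p<q q<r)
  <₀-≤₀∞-trans (just r) p<q (inj₂ refl)   = inj₁ p<q

  <₀⇒≱₀∞ : ∀ {p q} → p <₀ q → ¬ _≤₀∞_ G (just q) (just p)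
  <₀⇒≱₀∞ p<q (inj₁ q<p)  = <₀-irrefl refl (<₀-trans p<q q<p)
  <₀⇒≱₀∞ p<q (inj₂ refl) = <₀-irrefl refl p<q

  ≤₀∞-antisym : ∀ {p} w → _≤₀∞_ G (just p) w → _≤₀∞_ G w (just p) → w ≡ just p
  ≤₀∞-antisym nothing  _           (lift ())
  ≤₀∞-antisym (just r) (inj₂ refl) _           = refl
  ≤₀∞-antisym (just r) (inj₁ _)    (inj₂ refl) = refl
  ≤₀∞-antisym (just r) (inj₁ p<r)  (inj₁ r<p)  = ⊥-elim (<₀-irrefl refl (<₀-trans p<r r<p))

  ≥₀min-<⇒≥ : ∀ {p q} w → p <₀ q → ≥₀min G w (just p) (just q) → _≤₀∞_ G (just p) w
  ≥₀min-<⇒≥ w p<q (inj₁ p≤w) = p≤w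
  ≥₀min-<⇒≥ w p<q (inj₂ q≤w) = <₀-≤₀∞-trans w p<q q≤w

  ≥₀min-<⇒≤ : ∀ {p q} w → p <₀ q → ≥₀min G (just p) w (just q) → _≤₀∞_ G w (just p)
  ≥₀min-<⇒≤ w p<q (inj₁ w≤p) = w≤p
  ≥₀min-<⇒≤ w p<q (inj₂ q≤p) = ⊥-elim (<₀⇒≱₀∞ p<q q≤p)

module HamelValuationProperties {c g} {C : OrderedField c} (G : TwoOrderedVectorSpace C g)
                                {v : TwoOrderedVectorSpace.Carrier G → G∞ G}
                                (isHamel : IsHamelValuation G v) where
  open TwoOrderedVectorSpace G
  open IsHamelValuation isHamel
  open IsStrictLinearOrder <₀-linear using () renaming (compare to <₀-compare)
  open OrderedFieldProperties C using (-1#≢0#; _≟0#)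
  open VectorSpaceProperties G
  open ExtendedOrderProperties G

  v-neg : ∀ x → v (- x) ≡ v x
  v-neg x = trans (cong v (sym (-1·x≡-x x))) (v-· (F.- F.1#) x -1#≢0#)

  v-+-< : ∀ {x y p q} → v x ≡ just p → v y ≡ just q → p <₀ q → v (x + y) ≡ just p
  v-+-< {x} {y} vx≡p vy≡q p<q =
    ≤₀∞-antisym (v (x + y))
      (≥₀min-<⇒≥ (v (x + y)) p<q (subst₂ (≥₀min G (v (x + y))) vx≡p vy≡q (v-+ x y)))
      (≥₀min-<⇒≤ (v (x + y)) p<q
        (subst₂ (λ s t → ≥₀min G s (v (x + y)) t)
          (trans (cong v (+-cancelʳ x y)) vx≡p) (trans (v-neg y) vy≡q)
          (v-+ (x + y) (- y))))

  v-+-≢ : ∀ {x y p q} → v x ≡ just p → v y ≡ just q → p ≢ q →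
          v (x + y) ≡ just p ⊎ v (x + y) ≡ just q
  v-+-≢ {x} {y} {p} {q} vx≡p vy≡q p≢q with <₀-compare p q
  ... | tri< p<q _ _ = inj₁ (v-+-< vx≡p vy≡q p<q)
  ... | tri≈ _ p≡q _ = ⊥-elim (p≢q p≡q)
  ... | tri> _ _ q<p = inj₂ (trans (cong v (+-comm x y)) (v-+-< vy≡q vx≡p q<p))

  v≡just⇒≢0 : ∀ {x y} → v x ≡ just y → x ≢ 0#
  v≡just⇒≢0 {x} vx≡y x≡0 with trans (sym vx≡y) (proj₂ (v-∞ x) x≡0)
  ... | ()

  v-·-fixed : ∀ {μ x} → μ ≢ F.0# → v x ≡ just x → v (μ · x) ≡ just x
  v-·-fixed {μ} {x} μ≢0 vx≡x = trans (v-· μ x μ≢0) vx≡x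

  v-+-zeroˡ : ∀ {x y} → x ≡ 0# → v (x + y) ≡ v y
  v-+-zeroˡ {y = y} refl = cong v (+-identityˡ y)

  v-+-zeroʳ : ∀ {x y} → y ≡ 0# → v (x + y) ≡ v x
  v-+-zeroʳ {x} refl = cong v (+-identityʳ x)

  v-∑-attained : ∀ n (e : Fin n → Carrier) → (∀ i j → e i ≡ e j → i ≡ j) →
                 (∀ i → v (e i) ≡ just (e i)) → (a : Fin n → F.Carrier) →
                 (∀ i → a i ≡ F.0#) ⊎ ∃[ i ] v (∑ G n (λ j → a j · e j)) ≡ just (e i)
  v-∑-attained zero    e e-inj ve≡e a = inj₁ λ ()
  v-∑-attained (suc n) e e-inj ve≡e a
    with v-∑-attained n (tail e) (λ i j eq → suc-injective (e-inj (suc i) (suc j) eq))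
                      (ve≡e ∘ suc) (tail a)
       | head a ≟0#
  ... | inj₁ tail≡0 | yes head≡0 = inj₁ λ { zero → head≡0 ; (suc i) → tail≡0 i }
  ... | inj₁ tail≡0 | no  head≢0 =
    inj₂ (zero , trans (v-+-zeroʳ (∑-zero n (tail a) (tail e) tail≡0)) (v-·-fixed head≢0 (ve≡e zero)))
  ... | inj₂ (i , vR≡ei) | yes head≡0 =
    inj₂ (suc i , trans (v-+-zeroˡ (trans (cong (_· head e) head≡0) (·-zeroˡ (head e)))) vR≡ei)
  ... | inj₂ (i , vR≡ei) | no head≢0
    with v-+-≢ (v-·-fixed head≢0 (ve≡e zero)) vR≡ei (λ eq → 0≢1+n (e-inj zero (suc i) eq))
  ...   | inj₁ v∑≡e0 = inj₂ (zero , v∑≡e0)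
  ...   | inj₂ v∑≡ei = inj₂ (suc i , v∑≡ei)

module HamelSpaceProperties {c g} {C : OrderedField c} (H : HamelSpace C g) where
  open HamelSpace H
  open TwoOrderedVectorSpace space
  open IsHamelValuation isHamel
  open HamelValuationProperties space isHamel

  valueSet-fixed : ∀ {y} → valueSet H y → v y ≡ just y
  valueSet-fixed (x , _ , vx≡y) = trans (cong (ext space v) (sym vx≡y)) (trans (v-idem x) vx≡y)

  valueSet-linearlyIndependent : LinearlyIndependent space (valueSet H)
  valueSet-linearlyIndependent n e e-inj e∈V a ∑≡0 i
    with v-∑-attained n e e-inj (valueSet-fixed ∘ e∈V) a
  ... | inj₁ a≡0 = a≡0 i
  ... | inj₂ (_ , v∑≡e) = ⊥-elim (v≡just⇒≢0 v∑≡e ∑≡0)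

lemma4p3 : ∀ {c g : Level} (C : OrderedField c) (H : HamelSpace C g) →
    LinearlyIndependent (HamelSpace.space H) (valueSet H)
lemma4p3 C H = HamelSpaceProperties.valueSet-linearlyIndependent H
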